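{- Let $p$ be any pattern in the symmetry class of one of $(12,\emptyset,\{0\})$, $(12,\{0\},\{1\})$, $(12,\{0\},\{2\})$. Then for all $n\ge1$, $a_n(p)=(n-1)!$.
   Context: A bi-vincular pattern of length $k$ is a triple $p=(\sigma,X,Y)$ with $\sigma$ a permutation of $[k]$ in one-line notation and $X,Y\subseteq\{0,1,\dots,k\}$. A permutation $\pi=\pi_1\cdots\pi_n$ of $[n]$ contains $p$ if there are indices $1\le i_1<\dots<i_k\le n$ such that $(\pi_{i_1},\dots,\pi_{i_k})$ is order-isomorphic to $\sigma$ and, writing $j_1<\dots<j_k$ for the set $\{\pi_{i_1},\dots,\pi_{i_k}\}$ in increasing order and setting $i_0=j_0=0$, $i_{k+1}=j_{k+1}=n+1$, we have $i_{x+1}=i_x+1$ for all $x\in X$ and $j_{y+1}=j_y+1$ for all $y\in Y$. Otherwise $\pi$ avoids $p$; $a_n(p)$ is the number of permutations of $[n]$ avoiding $p$. For $p=(\sigma,X,Y)$ of length $k$ define $p^{i}=(\sigma^{ -1},Y,X)$, $p^{r}=(\sigma^{r},\{k-x:x\in X\},Y)$, $p^{c}=(\sigma^{c},X,\{k-y:y\in Y\})$, with $\sigma^r_m=\sigma_{k+1-m}$ and $\sigma^c_m=k+1-\sigma_m$; the symmetry class of $p$ is the set of patterns obtained from $p$ by finite compositions of $i,r,c$. -}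

module Defs where

open import Data.Nat using (ℕ; zero; suc; _+_)
open import Data.Fin using (Fin; zero; suc; toℕ; inject₁; opposite; _<_)
open import Data.Fin.Subset using (Subset; _∈_; ⁅_⁆; ⊥)
open import Data.Vec using (Vec; lookup; reverse; map; _∷_; [])
open import Data.List using (List; length)
open import Data.List.Relation.Unary.All using (All)
open import Data.List.Relation.Unary.Unique.Propositional using (Unique)
open import Data.List.Membership.Propositional using () renaming (_∈_ to _∈ₗ_)
open import Data.Product using (Σ; _×_)
open import Function.Definitions using (Injective)
open import Relation.Binary.PropositionalEquality using (_≡_)
open import Relation.Nullary using (¬_)

-- A permutation of [n] in one-line notation, 0-based: entry at position a
-- (0-based) is π_{a+1} - 1.  It is a permutation iff lookup is injective.
IsPerm : ∀ {n} → Vec (Fin n) n → Set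
IsPerm π = Injective _≡_ _≡_ (lookup π)

record Pattern (k : ℕ) : Set where
  constructor pat
  field
    σ : Vec (Fin k) k
    X : Subset (suc k)
    Y : Subset (suc k)
open Pattern public

StrictlyIncreasing : ∀ {k n} → (Fin k → Fin n) → Set
StrictlyIncreasing f = ∀ a b → a < b → f a < f b

ext′ : ∀ {k n} → (Fin k → Fin n) → Fin (suc k) → ℕ
ext′ {zero}  {n} f zero    = suc n
ext′ {suc k} {n} f zero    = suc (toℕ (f zero))
ext′ {suc k} {n} f (suc m) = ext′ (λ a → f (suc a)) m

-- ext f : the 1-based sequence (i_0 = 0, i_1, …, i_k, i_{k+1} = n+1)
ext : ∀ {k n} → (Fin k → Fin n) → Fin (suc (suc k)) → ℕ
ext f zero    = 0
ext f (suc m) = ext′ f m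

Adjacent : ∀ {k n} → Subset (suc k) → (Fin k → Fin n) → Set
Adjacent X f = ∀ x → x ∈ X → ext f (suc x) ≡ suc (ext f (inject₁ x))

-- π contains p: positions i_1<…<i_k and the sorted values j_1<…<j_k of the
-- occurrence; order-isomorphism to σ means π_{i_a} = j_{σ_a}.
Contains : ∀ {k n} → Pattern k → Vec (Fin n) n → Set
Contains {k} {n} p π =
  Σ (Fin k → Fin n) λ i → Σ (Fin k → Fin n) λ j →
    StrictlyIncreasing i × StrictlyIncreasing j ×
    (∀ a → lookup π (i a) ≡ j (lookup (σ p) a)) ×
    Adjacent (X p) i × Adjacent (Y p) j

Avoids : ∀ {k n} → Pattern k → Vec (Fin n) n → Set
Avoids p π = ¬ Contains p π

-- a_n(p) = c : there is a duplicate-free list of exactly the permutations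
-- of [n] avoiding p, and its length is c.
AvoidCount : ∀ {k} → Pattern k → (n c : ℕ) → Set
AvoidCount {k} p n c =
  Σ (List (Vec (Fin n) n)) λ L →
    Unique L × All (λ π → IsPerm π × Avoids p π) L ×
    (∀ π → IsPerm π → Avoids p π → π ∈ₗ L) × length L ≡ c

InverseOf : ∀ {k} → Vec (Fin k) k → Vec (Fin k) k → Set
InverseOf σ τ = (∀ a → lookup τ (lookup σ a) ≡ a) × (∀ a → lookup σ (lookup τ a) ≡ a)

-- p^r : σ reversed, X ↦ {k - x}, which on the Bool vector is reversal
_ʳ : ∀ {k} → Pattern k → Pattern k
pat σ X Y ʳ = pat (reverse σ) (reverse X) Y

-- p^c : σ complemented, Y ↦ {k - y}
_ᶜ : ∀ {k} → Pattern k → Pattern k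
pat σ X Y ᶜ = pat (map opposite σ) X (reverse Y)

σ12 : Vec (Fin 2) 2
σ12 = zero ∷ suc zero ∷ []

base₁ base₂ base₃ : Pattern 2
base₁ = pat σ12 ⊥ ⁅ zero ⁆
base₂ = pat σ12 ⁅ zero ⁆ ⁅ suc zero ⁆
base₃ = pat σ12 ⁅ zero ⁆ ⁅ suc (suc zero) ⁆

data SymClass {k} (p : Pattern k) : Pattern k → Set where
  base : SymClass p p
  rev  : ∀ {q} → SymClass p q → SymClass p (q ʳ)
  comp : ∀ {q} → SymClass p q → SymClass p (q ᶜ)
  inv  : ∀ {q τ} → SymClass p q → InverseOf (σ q) τ → SymClass p (pat τ (Y q) (X q))

-- Call p PINNED if in every length n = m+1 there are a position P and a value
-- W such that π avoids p exactly when π(P) = W.  Inserting W at position P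
-- into a permutation of [m] is a bijection onto the permutations with
-- π(P) = W, so a pinned pattern has m! avoiders of length m+1.
--
-- Next,
-- inverse, reverse and complement send pinned patterns to pinned patterns, so
-- pinnedness holds for a whole symmetry class.  Finally the base patterns are
-- pinned: (12,∅,{0}) by π(n) = 1, the other two by π(1) = n.
module Submission where

open import Defs
open import Data.Nat using (ℕ; suc; _!)
open import Data.Sum using (_⊎_; inj₁; inj₂)

open import Data.Nat using (zero; _*_; _+_; z≤n; s≤s)
import Data.Nat.Properties as ℕP
open import Data.Fin as F
  using (Fin; zero; suc; toℕ; fromℕ; inject₁; opposite; punchIn; punchOut)
import Data.Fin.Properties as FP
open import Data.Fin.Subset using (Subset; ⁅_⁆; _∈_)
open import Data.Fin.Subset.Properties using (∉⊥; x∈⁅x⁆; x∈⁅y⁆⇒x≡y)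
open import Relation.Nullary.Decidable using (decidable-stable)
open import Data.Vec as V using (Vec; []; _∷_; lookup; insertAt; tabulate; reverse)
import Data.Vec.Properties as VP
open import Data.List as L using (List; cartesianProductWith; allFin; length)
import Data.List.Properties as LP
import Data.List.Relation.Unary.All as All
import Data.List.Relation.Unary.AllPairs as AllPairs
open import Data.List.Relation.Unary.Unique.Propositional using (Unique)
import Data.List.Relation.Unary.Unique.Propositional.Properties as Unique
open import Data.List.Relation.Unary.Any using () renaming (here to lhere)
open import Data.List.Membership.Propositional using () renaming (_∈_ to _∈ₗ_)
import Data.List.Membership.Propositional.Properties as ∈ₗ
open import Data.Product using (Σ; _×_; _,_; proj₁; proj₂)
open import Data.Empty using (⊥-elim)
open import Function.Bundles using (_⇔_; mk⇔; Equivalence)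
open import Function.Construct.Composition using (_⇔-∘_)
open import Function.Base using (_∘′_)
open import Function.Definitions using (Injective)
open import Relation.Binary.PropositionalEquality
open import Relation.Nullary using (¬_; yes; no)

open Equivalence using (to; from)

vec-ext : ∀ {A : Set} {n} {u v : Vec A n} → (∀ i → lookup u i ≡ lookup v i) → u ≡ v
vec-ext {u = u} {v} same = begin
  u                   ≡⟨ VP.tabulate∘lookup u ⟨
  tabulate (lookup u) ≡⟨ VP.tabulate-cong same ⟩
  tabulate (lookup v) ≡⟨ VP.tabulate∘lookup v ⟩
  v                   ∎
  where open ≡-Reasoning

lookup-reverse : ∀ {A : Set} {n} (xs : Vec A n) i → lookup (reverse xs) i ≡ lookup xs (opposite i)
lookup-reverse xs i =
  trans (cong (lookup (reverse xs)) (sym (FP.opposite-involutive i))) (reverse-at-opposite xs (opposite i))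
  where
  lookup-∷ʳ-inject₁ : ∀ {A : Set} {n} (ys : Vec A n) y j → lookup (ys V.∷ʳ y) (inject₁ j) ≡ lookup ys j
  lookup-∷ʳ-inject₁ (_ ∷ _)  y zero    = refl
  lookup-∷ʳ-inject₁ (_ ∷ ys) y (suc j) = lookup-∷ʳ-inject₁ ys y j
  lookup-∷ʳ-last : ∀ {A : Set} {n} (ys : Vec A n) y → lookup (ys V.∷ʳ y) (fromℕ n) ≡ y
  lookup-∷ʳ-last []       y = refl
  lookup-∷ʳ-last (_ ∷ ys) y = lookup-∷ʳ-last ys y
  reverse-at-opposite : ∀ {A : Set} {n} (ys : Vec A n) j → lookup (reverse ys) (opposite j) ≡ lookup ys j
  reverse-at-opposite (y ∷ ys) j rewrite VP.reverse-∷ y ys with j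
  ... | zero  = lookup-∷ʳ-last (reverse ys) y
  ... | suc j = trans (lookup-∷ʳ-inject₁ (reverse ys) y (opposite j)) (reverse-at-opposite ys j)

opposite-injective : ∀ {n} {a b : Fin n} → opposite a ≡ opposite b → a ≡ b
opposite-injective {a = a} {b} e =
  trans (sym (FP.opposite-involutive a)) (trans (cong opposite e) (FP.opposite-involutive b))

opposite-< : ∀ {n} {a b : Fin n} → a F.< b → opposite b F.< opposite a
opposite-< {a = a} {b} a<b rewrite FP.opposite-prop a | FP.opposite-prop b =
  ℕP.∸-monoʳ-< (s≤s a<b) (FP.toℕ<n b)

opposite-fromℕ : ∀ k → opposite (fromℕ k) ≡ zero
opposite-fromℕ zero    = refl
opposite-fromℕ (suc k) = cong inject₁ (opposite-fromℕ k)

opposite-inject₁ : ∀ {k} (a : Fin k) → opposite (inject₁ a) ≡ suc (opposite a)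
opposite-inject₁ zero    = refl
opposite-inject₁ (suc a) = cong inject₁ (opposite-inject₁ a)

opposite-+ : ∀ {n} (a : Fin n) → toℕ (opposite a) + suc (toℕ a) ≡ n
opposite-+ a = trans (cong (_+ suc (toℕ a)) (FP.opposite-prop a)) (ℕP.m∸n+n≡m (FP.toℕ<n a))

ext-inner : ∀ {k n} (f : Fin k → Fin n) a → ext f (suc (inject₁ a)) ≡ suc (toℕ (f a))
ext-inner f zero    = refl
ext-inner f (suc a) = ext-inner (λ b → f (suc b)) a

ext-last : ∀ {k n} (f : Fin k → Fin n) → ext f (suc (fromℕ k)) ≡ suc n
ext-last {zero}  f = refl
ext-last {suc k} f = ext-last (λ b → f (suc b))

data InnerOrLast {k} : Fin (suc k) → Set where
  inner : (a : Fin k) → InnerOrLast (inject₁ a)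
  last  : InnerOrLast (fromℕ k)

innerOrLast : ∀ {k} (t : Fin (suc k)) → InnerOrLast t
innerOrLast {zero}  zero    = last
innerOrLast {suc k} zero    = inner zero
innerOrLast {suc k} (suc t) with innerOrLast t
... | inner a = inner (suc a)
... | last    = last

-- Reflecting both index and value of a k-tuple in Fin n; this is how the
-- positions (under reverse) or the values (under complement) of an occurrence change.
mirror : ∀ {k n} → (Fin k → Fin n) → Fin k → Fin n
mirror f a = opposite (f (opposite a))

mirror-increasing : ∀ {k n} (f : Fin k → Fin n) → StrictlyIncreasing f → StrictlyIncreasing (mirror f)
mirror-increasing f inc a b a<b = opposite-< (inc _ _ (opposite-< a<b))

ext-mirror : ∀ {k n} (f : Fin k → Fin n) t → ext (mirror f) t + ext f (opposite t) ≡ suc n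
ext-mirror f zero = ext-last f
ext-mirror {k} {n} f (suc t) with innerOrLast t
... | last = begin
  ext (mirror f) (suc (fromℕ k)) + ext f (inject₁ (opposite (fromℕ k)))
    ≡⟨ cong₂ (λ u v → u + ext f (inject₁ v)) (ext-last (mirror f)) (opposite-fromℕ k) ⟩
  suc n + 0
    ≡⟨ ℕP.+-identityʳ (suc n) ⟩
  suc n ∎
  where open ≡-Reasoning
... | inner a = begin
  ext (mirror f) (suc (inject₁ a)) + ext f (inject₁ (opposite (inject₁ a)))
    ≡⟨ cong₂ (λ u v → u + ext f (inject₁ v)) (ext-inner (mirror f) a) (opposite-inject₁ a) ⟩
  suc (toℕ (opposite y)) + ext f (suc (inject₁ (opposite a)))
    ≡⟨ cong (suc (toℕ (opposite y)) +_) (ext-inner f (opposite a)) ⟩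
  suc (toℕ (opposite y) + suc (toℕ y))
    ≡⟨ cong suc (opposite-+ y) ⟩
  suc n ∎
  where
  open ≡-Reasoning
  y : Fin n
  y = f (opposite a)

Adjacent-mirror : ∀ {k n} (X : Subset (suc k)) (f : Fin k → Fin n) →
                  Adjacent X f → Adjacent (reverse X) (mirror f)
Adjacent-mirror {k} {n} X f adj x x∈ = ℕP.+-cancelʳ-≡ (E (inject₁ y)) _ _ (begin
  E′ (suc x) + E (inject₁ y)                ≡⟨ ext-mirror f (suc x) ⟩
  suc n                                     ≡⟨ ext-mirror f (inject₁ x) ⟨
  E′ (inject₁ x) + E (opposite (inject₁ x)) ≡⟨ cong (λ t → E′ (inject₁ x) + E t) (opposite-inject₁ x) ⟩
  E′ (inject₁ x) + E (suc y)                ≡⟨ cong (E′ (inject₁ x) +_) (adj y y∈X) ⟩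
  E′ (inject₁ x) + suc (E (inject₁ y))      ≡⟨ ℕP.+-suc (E′ (inject₁ x)) (E (inject₁ y)) ⟩
  suc (E′ (inject₁ x)) + E (inject₁ y)      ∎)
  where
  open ≡-Reasoning
  E E′ : Fin (suc (suc k)) → ℕ
  E  = ext f
  E′ = ext (mirror f)
  y : Fin (suc k)
  y = opposite x
  y∈X : y ∈ X
  y∈X = VP.lookup⇒[]= y X (trans (sym (lookup-reverse X x)) (VP.[]=⇒lookup x∈))

injective⇒onto : ∀ {n} (f : Fin n → Fin n) → Injective _≡_ _≡_ f → ∀ y → Σ (Fin n) λ x → f x ≡ y
injective⇒onto f inj y with FP.any? (λ x → f x F.≟ y)
... | yes found = found
injective⇒onto {suc n} f inj y | no ¬found =
  ⊥-elim (ℕP.<-irrefl refl (FP.injective⇒≤ {f = squeeze} squeeze-injective))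
  where
  missed : ∀ x → y ≢ f x
  missed x e = ¬found (x , sym e)
  -- f avoids y, so removing y from the codomain injects Fin (suc n) into Fin n
  squeeze : Fin (suc n) → Fin n
  squeeze x = punchOut (missed x)
  squeeze-injective : Injective _≡_ _≡_ squeeze
  squeeze-injective e = inj (FP.punchOut-injective (missed _) (missed _) e)

inverse : ∀ {n} (π : Vec (Fin n) n) → IsPerm π → Vec (Fin n) n
inverse π perm = tabulate λ b → proj₁ (injective⇒onto (lookup π) perm b)

inverseʳ : ∀ {n} (π : Vec (Fin n) n) (perm : IsPerm π) b → lookup π (lookup (inverse π perm) b) ≡ b
inverseʳ π perm b =
  trans (cong (lookup π) (VP.lookup∘tabulate _ b)) (proj₂ (injective⇒onto (lookup π) perm b))

inverseˡ : ∀ {n} (π : Vec (Fin n) n) (perm : IsPerm π) a → lookup (inverse π perm) (lookup π a) ≡ a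
inverseˡ π perm a = perm (inverseʳ π perm (lookup π a))

inverse-isPerm : ∀ {n} (π : Vec (Fin n) n) (perm : IsPerm π) → IsPerm (inverse π perm)
inverse-isPerm π perm {a} {b} e =
  trans (sym (inverseʳ π perm a)) (trans (cong (lookup π) e) (inverseʳ π perm b))

reverse-isPerm : ∀ {n} (π : Vec (Fin n) n) → IsPerm π → IsPerm (reverse π)
reverse-isPerm π perm {a} {b} e =
  opposite-injective (perm (trans (sym (lookup-reverse π a)) (trans e (lookup-reverse π b))))

complement : ∀ {n m} → Vec (Fin n) m → Vec (Fin n) m
complement = V.map opposite

complement-involutive : ∀ {n m} (v : Vec (Fin n) m) → complement (complement v) ≡ v
complement-involutive v = vec-ext λ i → begin
  lookup (complement (complement v)) i ≡⟨ VP.lookup-map i opposite (complement v) ⟩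
  opposite (lookup (complement v) i)   ≡⟨ cong opposite (VP.lookup-map i opposite v) ⟩
  opposite (opposite (lookup v i))     ≡⟨ FP.opposite-involutive (lookup v i) ⟩
  lookup v i                           ∎
  where open ≡-Reasoning

complement-isPerm : ∀ {n} (π : Vec (Fin n) n) → IsPerm π → IsPerm (complement π)
complement-isPerm π perm {a} {b} e =
  perm (opposite-injective (trans (sym (VP.lookup-map a opposite π)) (trans e (VP.lookup-map b opposite π))))

-- insert P W ρ: the permutation of [m+1] that maps P to W and otherwise
-- follows ρ, with the positions ≥ P and the values ≥ W shifted up by one.
insert : ∀ {m} → Fin (suc m) → Fin (suc m) → Vec (Fin m) m → Vec (Fin (suc m)) (suc m)
insert P W ρ = insertAt (V.map (punchIn W) ρ) P W

insert-at : ∀ {m} P W (ρ : Vec (Fin m) m) → lookup (insert P W ρ) P ≡ W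
insert-at P W ρ = VP.insertAt-lookup (V.map (punchIn W) ρ) P W

insert-elsewhere : ∀ {m} P W (ρ : Vec (Fin m) m) i →
                   lookup (insert P W ρ) (punchIn P i) ≡ punchIn W (lookup ρ i)
insert-elsewhere P W ρ i =
  trans (VP.insertAt-punchIn (V.map (punchIn W) ρ) P W i) (VP.lookup-map i (punchIn W) ρ)

data PositionView {m} (P : Fin (suc m)) : Fin (suc m) → Set where
  at        : PositionView P P
  elsewhere : ∀ i → PositionView P (punchIn P i)

positionView : ∀ {m} (P a : Fin (suc m)) → PositionView P a
positionView P a with P F.≟ a
... | yes refl = at
... | no P≢a   = subst (PositionView P) (FP.punchIn-punchOut P≢a) (elsewhere _)

insert-isPerm : ∀ {m} P W (ρ : Vec (Fin m) m) → IsPerm ρ → IsPerm (insert P W ρ)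
insert-isPerm P W ρ perm {a} {b} = compare (positionView P a) (positionView P b)
  where
  τ : Vec (Fin (suc _)) (suc _)
  τ = insert P W ρ
  compare : ∀ {a b} → PositionView P a → PositionView P b → lookup τ a ≡ lookup τ b → a ≡ b
  compare at at _ = refl
  compare at (elsewhere j) e = ⊥-elim (FP.punchInᵢ≢i W (lookup ρ j)
    (trans (sym (insert-elsewhere P W ρ j)) (trans (sym e) (insert-at P W ρ))))
  compare (elsewhere i) at e = ⊥-elim (FP.punchInᵢ≢i W (lookup ρ i)
    (trans (sym (insert-elsewhere P W ρ i)) (trans e (insert-at P W ρ))))
  compare (elsewhere i) (elsewhere j) e = cong (punchIn P) (perm (FP.punchIn-injective W _ _
    (trans (sym (insert-elsewhere P W ρ i)) (trans e (insert-elsewhere P W ρ j)))))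

insert-injective : ∀ {m} P W {ρ ρ′ : Vec (Fin m) m} → insert P W ρ ≡ insert P W ρ′ → ρ ≡ ρ′
insert-injective P W {ρ} {ρ′} e = vec-ext λ i → FP.punchIn-injective W _ _
  (trans (sym (insert-elsewhere P W ρ i))
    (trans (cong (λ τ → lookup τ (punchIn P i)) e) (insert-elsewhere P W ρ′ i)))

insert-onto : ∀ {m} P W (π : Vec (Fin (suc m)) (suc m)) → IsPerm π → lookup π P ≡ W →
              Σ (Vec (Fin m) m) λ ρ → IsPerm ρ × insert P W ρ ≡ π
insert-onto {m} P W π perm πP≡W = ρ , ρ-isPerm , vec-ext λ a → agree (positionView P a)
  where
  avoidsW : ∀ i → W ≢ lookup π (punchIn P i)
  avoidsW i e = FP.punchInᵢ≢i P i (perm (trans (sym e) (sym πP≡W)))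
  ρ : Vec (Fin m) m
  ρ = tabulate λ i → punchOut (avoidsW i)
  lookup-ρ : ∀ i → lookup ρ i ≡ punchOut (avoidsW i)
  lookup-ρ i = VP.lookup∘tabulate (λ i → punchOut (avoidsW i)) i
  ρ-isPerm : IsPerm ρ
  ρ-isPerm {i} {j} e = FP.punchIn-injective P i j (perm (FP.punchOut-injective (avoidsW i) (avoidsW j)
    (trans (sym (lookup-ρ i)) (trans e (lookup-ρ j)))))
  agree : ∀ {a} → PositionView P a → lookup (insert P W ρ) a ≡ lookup π a
  agree at            = trans (insert-at P W ρ) (sym πP≡W)
  agree (elsewhere i) = trans (insert-elsewhere P W ρ i)
    (trans (cong (punchIn W) (lookup-ρ i)) (FP.punchIn-punchOut (avoidsW i)))

length-cartesianProductWith : ∀ {A B C : Set} (f : A → B → C) xs ys →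
  length (cartesianProductWith f xs ys) ≡ length xs * length ys
length-cartesianProductWith f L.[]       ys = refl
length-cartesianProductWith f (x L.∷ xs) ys = begin
  length (L.map (f x) ys L.++ cartesianProductWith f xs ys)
    ≡⟨ LP.length-++ (L.map (f x) ys) ⟩
  length (L.map (f x) ys) + length (cartesianProductWith f xs ys)
    ≡⟨ cong₂ _+_ (LP.length-map (f x) ys) (length-cartesianProductWith f xs ys) ⟩
  length ys + length xs * length ys ∎
  where open ≡-Reasoning

permutations : ∀ m → List (Vec (Fin m) m)
permutations zero    = [] L.∷ L.[]
permutations (suc m) = cartesianProductWith (insert zero) (allFin (suc m)) (permutations m)

permutations-sound : ∀ m {π} → π ∈ₗ permutations m → IsPerm π
permutations-sound zero    {[]} _ {()}
permutations-sound (suc m) π∈ with ∈ₗ.∈-cartesianProductWith⁻ (insert zero) (allFin (suc m)) (permutations m) π∈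
... | W , ρ , _ , ρ∈ , refl = insert-isPerm zero W ρ (permutations-sound m ρ∈)

permutations-complete : ∀ m (π : Vec (Fin m) m) → IsPerm π → π ∈ₗ permutations m
permutations-complete zero    []  _    = lhere refl
permutations-complete (suc m) π perm with insert-onto zero (lookup π zero) π perm refl
... | ρ , ρ-isPerm , inserted = subst (_∈ₗ permutations (suc m)) inserted
  (∈ₗ.∈-cartesianProductWith⁺ (insert zero) (∈ₗ.∈-allFin (lookup π zero)) (permutations-complete m ρ ρ-isPerm))

permutations-unique : ∀ m → Unique (permutations m)
permutations-unique zero    = All.[] AllPairs.∷ AllPairs.[]
permutations-unique (suc m) = Unique.cartesianProductWith⁺ (insert zero) split
  (Unique.allFin⁺ (suc m)) (permutations-unique m)
  where
  -- the first entry of insert zero W ρ is W, and the rest determines ρ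
  split : ∀ {W W′ ρ ρ′} → insert zero W ρ ≡ insert zero W′ ρ′ → W ≡ W′ × ρ ≡ ρ′
  split e with cong V.head e
  ... | refl = refl , insert-injective zero _ e

permutations-length : ∀ m → length (permutations m) ≡ m !
permutations-length zero    = refl
permutations-length (suc m) =
  trans (length-cartesianProductWith (insert zero) (allFin (suc m)) (permutations m))
        (cong₂ _*_ (LP.length-tabulate {n = suc m} (λ W → W)) (permutations-length m))

permutationsThrough : ∀ {m} (P W : Fin (suc m)) → List (Vec (Fin (suc m)) (suc m))
permutationsThrough P W = L.map (insert P W) (permutations _)

permutationsThrough-sound : ∀ {m} (P W : Fin (suc m)) {π} → π ∈ₗ permutationsThrough P W →
                            IsPerm π × lookup π P ≡ W
permutationsThrough-sound {m} P W π∈ with ∈ₗ.∈-map⁻ (insert P W) π∈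
... | ρ , ρ∈ , refl = insert-isPerm P W ρ (permutations-sound m ρ∈) , insert-at P W ρ

permutationsThrough-complete : ∀ {m} (P W : Fin (suc m)) π → IsPerm π → lookup π P ≡ W →
                               π ∈ₗ permutationsThrough P W
permutationsThrough-complete {m} P W π perm πP≡W with insert-onto P W π perm πP≡W
... | ρ , ρ-isPerm , inserted = subst (_∈ₗ permutationsThrough P W) inserted
  (∈ₗ.∈-map⁺ (insert P W) (permutations-complete m ρ ρ-isPerm))

permutationsThrough-unique : ∀ {m} (P W : Fin (suc m)) → Unique (permutationsThrough P W)
permutationsThrough-unique {m} P W = Unique.map⁺ (insert-injective P W) (permutations-unique m)

permutationsThrough-length : ∀ {m} (P W : Fin (suc m)) → length (permutationsThrough P W) ≡ m !
permutationsThrough-length {m} P W = trans (LP.length-map (insert P W) (permutations m)) (permutations-length m)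

PinnedAt : ∀ {k n} → Pattern k → Fin n → Fin n → Set
PinnedAt p P W = ∀ π → IsPerm π → Avoids p π ⇔ lookup π P ≡ W

Pinned : ∀ {k} → Pattern k → Set
Pinned p = ∀ m → Σ (Fin (suc m)) λ P → Σ (Fin (suc m)) λ W → PinnedAt p P W

pinned-count : ∀ {k} (p : Pattern k) → Pinned p → ∀ m → AvoidCount p (suc m) (m !)
pinned-count p pinned m with pinned m
... | P , W , pinnedAt =
  permutationsThrough P W , permutationsThrough-unique P W ,
  All.tabulate sound , complete , permutationsThrough-length P W
  where
  sound : ∀ {π} → π ∈ₗ permutationsThrough P W → IsPerm π × Avoids p π
  sound {π} π∈ with permutationsThrough-sound P W π∈
  ... | perm , πP≡W = perm , from (pinnedAt π perm) πP≡W
  complete : ∀ π → IsPerm π → Avoids p π → π ∈ₗ permutationsThrough P W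
  complete π perm avoids = permutationsThrough-complete P W π perm (to (pinnedAt π perm) avoids)

reverse-contains : ∀ {k n} (p : Pattern k) (π : Vec (Fin n) n) → Contains p π → Contains (p ʳ) (reverse π)
reverse-contains (pat σ X Y) π (i , j , i-inc , j-inc , match , adjX , adjY) =
  mirror i , j , mirror-increasing i i-inc , j-inc , match′ , Adjacent-mirror X i adjX , adjY
  where
  open ≡-Reasoning
  match′ : ∀ a → lookup (reverse π) (mirror i a) ≡ j (lookup (reverse σ) a)
  match′ a = begin
    lookup (reverse π) (opposite (i (opposite a)))  ≡⟨ lookup-reverse π _ ⟩
    lookup π (opposite (opposite (i (opposite a)))) ≡⟨ cong (lookup π) (FP.opposite-involutive _) ⟩
    lookup π (i (opposite a))                       ≡⟨ match (opposite a) ⟩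
    j (lookup σ (opposite a))                       ≡⟨ cong j (lookup-reverse σ a) ⟨
    j (lookup (reverse σ) a)                        ∎

complement-contains : ∀ {k n} (p : Pattern k) (π : Vec (Fin n) n) → Contains p π → Contains (p ᶜ) (complement π)
complement-contains (pat σ X Y) π (i , j , i-inc , j-inc , match , adjX , adjY) =
  i , mirror j , i-inc , mirror-increasing j j-inc , match′ , adjX , Adjacent-mirror Y j adjY
  where
  open ≡-Reasoning
  match′ : ∀ a → lookup (complement π) (i a) ≡ mirror j (lookup (complement σ) a)
  match′ a = begin
    lookup (complement π) (i a)                   ≡⟨ VP.lookup-map (i a) opposite π ⟩
    opposite (lookup π (i a))                     ≡⟨ cong opposite (match a) ⟩
    opposite (j (lookup σ a))                     ≡⟨ cong (opposite ∘′ j) (FP.opposite-involutive _) ⟨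
    opposite (j (opposite (opposite (lookup σ a)))) ≡⟨ cong (mirror j) (VP.lookup-map a opposite σ) ⟨
    mirror j (lookup (complement σ) a)            ∎

-- If ρ is a left inverse of π, an occurrence of p in π gives one of p^i in ρ:
-- positions and values trade places.
inverse-contains : ∀ {k n} (p : Pattern k) τ → InverseOf (σ p) τ → (π ρ : Vec (Fin n) n) →
                   (∀ a → lookup ρ (lookup π a) ≡ a) → Contains p π → Contains (pat τ (Y p) (X p)) ρ
inverse-contains p τ (_ , σ∘τ) π ρ ρ∘π (i , j , i-inc , j-inc , match , adjX , adjY) =
  j , i , j-inc , i-inc , match′ , adjY , adjX
  where
  open ≡-Reasoning
  match′ : ∀ b → lookup ρ (j b) ≡ i (lookup τ b)
  match′ b = begin
    lookup ρ (j b)                             ≡⟨ cong (lookup ρ ∘′ j) (σ∘τ b) ⟨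
    lookup ρ (j (lookup (σ p) (lookup τ b)))   ≡⟨ cong (lookup ρ) (match (lookup τ b)) ⟨
    lookup ρ (lookup π (i (lookup τ b)))       ≡⟨ ρ∘π _ ⟩
    i (lookup τ b)                             ∎

reverse-pattern-involutive : ∀ {k} (p : Pattern k) → (p ʳ) ʳ ≡ p
reverse-pattern-involutive (pat σ X Y) =
  cong₂ (λ σ′ X′ → pat σ′ X′ Y) (VP.reverse-involutive σ) (VP.reverse-involutive X)

complement-pattern-involutive : ∀ {k} (p : Pattern k) → (p ᶜ) ᶜ ≡ p
complement-pattern-involutive (pat σ X Y) =
  cong₂ (λ σ′ Y′ → pat σ′ X Y′) (complement-involutive σ) (VP.reverse-involutive Y)

avoids-involution : ∀ {k n} (S : Pattern k → Pattern k) (Φ : Vec (Fin n) n → Vec (Fin n) n) →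
  (∀ p π → Contains p π → Contains (S p) (Φ π)) → (∀ p → S (S p) ≡ p) → (∀ π → Φ (Φ π) ≡ π) →
  ∀ p π → Avoids (S p) π ⇔ Avoids p (Φ π)
avoids-involution S Φ transport S-inv Φ-inv p π = mk⇔
  (λ avoids c → avoids (subst (Contains (S p)) (Φ-inv π) (transport p (Φ π) c)))
  (λ avoids c → avoids (subst (λ q → Contains q (Φ π)) (S-inv p) (transport (S p) π c)))

pinnedAt-transfer : ∀ {k n} {p q : Pattern k} {P W P′ W′ : Fin n}
  (Φ : (π : Vec (Fin n) n) → IsPerm π → Vec (Fin n) n) →
  (∀ π (perm : IsPerm π) → IsPerm (Φ π perm)) →
  (∀ π (perm : IsPerm π) → Avoids q π ⇔ Avoids p (Φ π perm)) →
  (∀ π (perm : IsPerm π) → (lookup (Φ π perm) P ≡ W) ⇔ (lookup π P′ ≡ W′)) →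
  PinnedAt p P W → PinnedAt q P′ W′
pinnedAt-transfer Φ Φ-isPerm avoidance pinning pinnedAt π perm =
  pinning π perm ⇔-∘ (pinnedAt (Φ π perm) (Φ-isPerm π perm) ⇔-∘ avoidance π perm)

≡-lhs : ∀ {A : Set} {a b c : A} → a ≡ b → (a ≡ c) ⇔ (b ≡ c)
≡-lhs a≡b = mk⇔ (trans (sym a≡b)) (trans a≡b)

pinned-reverse : ∀ {k} (p : Pattern k) → Pinned p → Pinned (p ʳ)
pinned-reverse p pinned m with pinned m
... | P , W , pinnedAt = opposite P , W ,
  pinnedAt-transfer {p = p} {q = p ʳ} (λ π _ → reverse π) reverse-isPerm
    (λ π _ → avoids-involution _ʳ reverse reverse-contains reverse-pattern-involutive VP.reverse-involutive p π)
    (λ π _ → ≡-lhs (lookup-reverse π P))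
    pinnedAt

pinned-complement : ∀ {k} (p : Pattern k) → Pinned p → Pinned (p ᶜ)
pinned-complement p pinned m with pinned m
... | P , W , pinnedAt = P , opposite W ,
  pinnedAt-transfer {p = p} {q = p ᶜ} (λ π _ → complement π) complement-isPerm
    (λ π _ → avoids-involution _ᶜ complement complement-contains complement-pattern-involutive
                                complement-involutive p π)
    (λ π _ → flip-opposite (lookup π P) ⇔-∘ ≡-lhs (VP.lookup-map P opposite π))
    pinnedAt
  where
  flip-opposite : ∀ a → (opposite a ≡ W) ⇔ (a ≡ opposite W)
  flip-opposite a = mk⇔ (λ e → trans (sym (FP.opposite-involutive a)) (cong opposite e))
                        (λ e → trans (cong opposite e) (FP.opposite-involutive W))

-- p^i is pinned at (W, P): π maps W to P iff its inverse maps P to W.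
pinned-inverse : ∀ {k} (p : Pattern k) τ → InverseOf (σ p) τ → Pinned p → Pinned (pat τ (Y p) (X p))
pinned-inverse p τ (τ∘σ , σ∘τ) pinned m with pinned m
... | P , W , pinnedAt = W , P ,
  pinnedAt-transfer {p = p} {q = pat τ (Y p) (X p)} inverse inverse-isPerm avoidance pinning pinnedAt
  where
  avoidance : ∀ π (perm : IsPerm π) → Avoids (pat τ (Y p) (X p)) π ⇔ Avoids p (inverse π perm)
  avoidance π perm = mk⇔
    (λ avoids c → avoids (inverse-contains p τ (τ∘σ , σ∘τ) (inverse π perm) π (inverseʳ π perm) c))
    (λ avoids c → avoids (inverse-contains (pat τ (Y p) (X p)) (σ p) (σ∘τ , τ∘σ) π (inverse π perm)
                                           (inverseˡ π perm) c))
  pinning : ∀ π (perm : IsPerm π) → (lookup (inverse π perm) P ≡ W) ⇔ (lookup π W ≡ P)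
  pinning π perm = mk⇔ (λ e → trans (cong (lookup π) (sym e)) (inverseʳ π perm P))
                       (λ e → trans (cong (lookup (inverse π perm)) (sym e)) (inverseˡ π perm W))

pinned-symmetryClass : ∀ {k} {b q : Pattern k} → Pinned b → SymClass b q → Pinned q
pinned-symmetryClass pinned base               = pinned
pinned-symmetryClass pinned (rev {q} s)        = pinned-reverse q (pinned-symmetryClass pinned s)
pinned-symmetryClass pinned (comp {q} s)       = pinned-complement q (pinned-symmetryClass pinned s)
pinned-symmetryClass pinned (inv {q} {τ} s iv) = pinned-inverse q τ iv (pinned-symmetryClass pinned s)

-- To prove p pinned at (P, W) it suffices to see that π P ≡ W forces
-- avoidance and π P ≢ W produces an occurrence (equality in Fin n is decidable).
pinnedAt-dichotomy : ∀ {k n} {p : Pattern k} {P W : Fin n} →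
  (∀ π → IsPerm π → lookup π P ≡ W → Avoids p π) →
  (∀ π → IsPerm π → lookup π P ≢ W → Contains p π) →
  PinnedAt p P W
pinnedAt-dichotomy {P = P} {W} avoids contains π perm = mk⇔
  (λ avoiding → decidable-stable (lookup π P F.≟ W) (λ πP≢W → avoiding (contains π perm πP≢W)))
  (avoids π perm)

nothing-above-last : ∀ {m} (b : Fin (suc m)) → ¬ (fromℕ m F.< b)
nothing-above-last b last<b = ℕP.<⇒≱ last<b (FP.≤fromℕ b)

below-last : ∀ {m} {a : Fin (suc m)} → a ≢ fromℕ m → a F.< fromℕ m
below-last {a = a} a≢last = FP.≤∧≢⇒< (FP.≤fromℕ a) a≢last

above-zero : ∀ {m} {b : Fin (suc m)} → b ≢ zero → zero {m} F.< b
above-zero {b = zero}  0≢0 = ⊥-elim (0≢0 refl)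
above-zero {b = suc _} _   = s≤s z≤n

successor : ∀ {m} (v : Fin (suc m)) → v ≢ fromℕ m → Fin (suc m)
successor {m} v v≢last = suc (F.lower₁ v (m≢v v≢last))
  where
  m≢v : v ≢ fromℕ m → m ≢ toℕ v
  m≢v v≢last m≡v = v≢last (FP.toℕ-injective (trans (sym m≡v) (sym (FP.toℕ-fromℕ m))))

toℕ-successor : ∀ {m} (v : Fin (suc m)) (v≢last : v ≢ fromℕ m) → toℕ (successor v v≢last) ≡ suc (toℕ v)
toℕ-successor v v≢last = cong suc (FP.toℕ-lower₁ v _)

Adjacent-zero : ∀ {k n} {X : Subset (suc (suc k))} (f : Fin (suc k) → Fin (suc n)) →
                Adjacent X f → zero ∈ X → f zero ≡ zero
Adjacent-zero f adj 0∈X with f zero | adj zero 0∈X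
... | zero | _ = refl

pair : ∀ {n} → Fin n → Fin n → Fin 2 → Fin n
pair x y zero    = x
pair x y (suc _) = y

pair-increasing : ∀ {n} {x y : Fin n} → x F.< y → StrictlyIncreasing (pair x y)
pair-increasing x<y zero       (suc zero) _ = x<y
pair-increasing x<y zero       zero       ()
pair-increasing x<y (suc zero) zero       ()
pair-increasing x<y (suc zero) (suc zero) (s≤s ())

pair-from-zero : ∀ {n} (y : Fin (suc n)) → Adjacent ⁅ zero ⁆ (pair zero y)
pair-from-zero y x x∈ with x∈⁅y⁆⇒x≡y zero x∈
... | refl = refl

ascent-contains : ∀ {n} {X Y : Subset 3} (π : Vec (Fin n) n) {a b u v : Fin n} →
  a F.< b → u F.< v → lookup π a ≡ u → lookup π b ≡ v →
  Adjacent X (pair a b) → Adjacent Y (pair u v) → Contains (pat σ12 X Y) π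
ascent-contains π a<b u<v πa≡u πb≡v adjX adjY =
  pair _ _ , pair _ _ , pair-increasing a<b , pair-increasing u<v , match , adjX , adjY
  where
  match : ∀ c → lookup π (pair _ _ c) ≡ pair _ _ (lookup σ12 c)
  match zero       = πa≡u
  match (suc zero) = πb≡v

-- (12, ∅, {0}) — a 1 followed later by a larger entry — is avoided iff π(n) = 1.
pinned₁ : Pinned base₁
pinned₁ m = fromℕ m , zero , pinnedAt-dichotomy {p = base₁} avoids contains
  where
  avoids : ∀ π → IsPerm π → lookup π (fromℕ m) ≡ zero → Avoids base₁ π
  avoids π perm πlast≡0 (i , j , i-inc , _ , match , _ , adjY) =
    nothing-above-last (i (suc zero)) (subst (F._< i (suc zero)) i0≡last (i-inc zero (suc zero) (s≤s z≤n)))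
    where
    i0≡last : i zero ≡ fromℕ m
    i0≡last = perm (trans (match zero) (trans (Adjacent-zero j adjY (x∈⁅x⁆ zero)) (sym πlast≡0)))
  contains : ∀ π → IsPerm π → lookup π (fromℕ m) ≢ zero → Contains base₁ π
  contains π perm πlast≢0 =
    ascent-contains π (below-last a≢last) (above-zero πlast≢0) (inverseʳ π perm zero) refl
      (λ _ x∈∅ → ⊥-elim (∉⊥ x∈∅)) (pair-from-zero (lookup π (fromℕ m)))
    where
    a≢last : lookup (inverse π perm) zero ≢ fromℕ m
    a≢last a≡last = πlast≢0 (trans (cong (lookup π) (sym a≡last)) (inverseʳ π perm zero))

-- If 0 ∈ X, every occurrence of (12, X, Y) starts at position 1, so the
-- pattern is avoided whenever π(1) = n.
first↦last-avoids : ∀ {m} (Y : Subset 3) (π : Vec (Fin (suc m)) (suc m)) →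
                    lookup π zero ≡ fromℕ m → Avoids (pat σ12 ⁅ zero ⁆ Y) π
first↦last-avoids {m} Y π π0≡last (i , j , _ , j-inc , match , adjX , _) =
  nothing-above-last (j (suc zero)) (subst (F._< j (suc zero)) j0≡last (j-inc zero (suc zero) (s≤s z≤n)))
  where
  j0≡last : j zero ≡ fromℕ m
  j0≡last = trans (sym (match zero)) (trans (cong (lookup π) (Adjacent-zero i adjX (x∈⁅x⁆ zero))) π0≡last)

first-ascent-contains : ∀ {m} {Y : Subset 3} (π : Vec (Fin (suc m)) (suc m)) → IsPerm π →
  ∀ w → lookup π zero F.< w → Adjacent Y (pair (lookup π zero) w) → Contains (pat σ12 ⁅ zero ⁆ Y) π
first-ascent-contains {m} π perm w π0<w adjY =
  ascent-contains π (above-zero b≢0) π0<w refl (inverseʳ π perm w) (pair-from-zero b) adjY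
  where
  b : Fin (suc m)
  b = lookup (inverse π perm) w
  b≢0 : b ≢ zero
  b≢0 b≡0 = FP.<⇒≢ π0<w (trans (cong (lookup π) (sym b≡0)) (inverseʳ π perm w))

-- (12, {0}, {1}) is avoided iff π(1) = n: otherwise π(1)+1 occurs later.
pinned₂ : Pinned base₂
pinned₂ m = zero , fromℕ m , pinnedAt-dichotomy {p = base₂} (λ π _ → first↦last-avoids _ π) contains
  where
  contains : ∀ π → IsPerm π → lookup π zero ≢ fromℕ m → Contains base₂ π
  contains π perm π0≢last = first-ascent-contains π perm (successor v π0≢last) v<v+1 adjY
    where
    v : Fin (suc m)
    v = lookup π zero
    v<v+1 : v F.< successor v π0≢last
    v<v+1 = ℕP.≤-reflexive (sym (toℕ-successor v π0≢last))
    adjY : Adjacent ⁅ suc zero ⁆ (pair v (successor v π0≢last))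
    adjY x x∈ with x∈⁅y⁆⇒x≡y (suc zero) x∈
    ... | refl = cong suc (toℕ-successor v π0≢last)

-- (12, {0}, {2}) is avoided iff π(1) = n: otherwise n occurs later.
pinned₃ : Pinned base₃
pinned₃ m = zero , fromℕ m , pinnedAt-dichotomy {p = base₃} (λ π _ → first↦last-avoids _ π) contains
  where
  contains : ∀ π → IsPerm π → lookup π zero ≢ fromℕ m → Contains base₃ π
  contains π perm π0≢last = first-ascent-contains π perm (fromℕ m) (below-last π0≢last) adjY
    where
    adjY : Adjacent ⁅ suc (suc zero) ⁆ (pair (lookup π zero) (fromℕ m))
    adjY x x∈ with x∈⁅y⁆⇒x≡y (suc (suc zero)) x∈
    ... | refl = cong (λ t → suc (suc t)) (sym (FP.toℕ-fromℕ m))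

mainTheorem2 : ∀ (p : Pattern 2) →
    (SymClass base₁ p ⊎ SymClass base₂ p ⊎ SymClass base₃ p) →
    ∀ (m : ℕ) → AvoidCount p (suc m) (m !)
mainTheorem2 p (inj₁ s)        = pinned-count p (pinned-symmetryClass pinned₁ s)
mainTheorem2 p (inj₂ (inj₁ s)) = pinned-count p (pinned-symmetryClass pinned₂ s)
mainTheorem2 p (inj₂ (inj₂ s)) = pinned-count p (pinned-symmetryClass pinned₃ s)
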